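{- Let $\psi=(\psi_n)_{n\ge 0}$ be a sequence of nonzero real numbers and put $n_\psi=\psi_{n-1}/\psi_n$ for $n\ge 1$. For $k\ge 0$ let $\psi_{\underline k}(x)=x(x-1_\psi)(x-2_\psi)\cdots(x-(k-1)_\psi)$ (with $\psi_{\underline 0}(x)=1$), and define $\left\{{n\atop k}\right\}^\sim_\psi$ by $x^n=\sum_{k=0}^{n}\left\{{n\atop k}\right\}^\sim_\psi\,\psi_{\underline k}(x)$ for $n\ge 0$. Then for all $n\ge k\ge 0$, $$\left\{{n\atop k}\right\}^\sim_\psi=\sum_{1\le i_1\le i_2\le\cdots\le i_{n-k}\le k}(i_1)_\psi(i_2)_\psi\cdots(i_{n-k})_\psi=\sum_{\substack{d_1+\cdots+d_k=n-k\\ d_i\ge 0}}1_\psi^{d_1}2_\psi^{d_2}\cdots k_\psi^{d_k}.$$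
   Context: Empty sums equal $0$ and empty products equal $1$ (so for $n=k$ the right-hand sides equal $1$). -}

module Defs where

open import Level using (Level; _⊔_)
open import Data.Nat as ℕ using (ℕ; zero; suc; _∸_)
open import Data.Nat.Properties using (_≤?_)
open import Data.Fin using (toℕ)
open import Data.List using (List; []; _∷_; map; concatMap; filter; foldr; upTo)
open import Data.List.Relation.Unary.Linked using (Linked; linked?)
open import Data.Vec as Vec using (Vec; []; _∷_; toList)
open import Relation.Nullary using (¬_; yes; no)
open import Relation.Binary.PropositionalEquality using (_≡_)
open import Algebra.Bundles using (CommutativeRing)

record Field (c ℓ : Level) : Set (Level.suc (c ⊔ ℓ)) where
  field
    commutativeRing : CommutativeRing c ℓ
  open CommutativeRing commutativeRing public
  field
    1≉0     : ¬ (1# ≈ 0#)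
    inv     : (x : Carrier) → ¬ (x ≈ 0#) → Carrier
    inverse : (x : Carrier) (x≉0 : ¬ (x ≈ 0#)) → x * inv x x≉0 ≈ 1#

allVecs : ∀ {a} {A : Set a} (m : ℕ) → List A → List (Vec A m)
allVecs zero    xs = [] ∷ []
allVecs (suc m) xs = concatMap (λ x → map (x ∷_) (allVecs m xs)) xs

-- [a .. b] as a list of naturals (empty if b < a).
range : ℕ → ℕ → List ℕ
range a b = map (a ℕ.+_) (upTo (suc b ∸ a))

module _ {c ℓ} (F : Field c ℓ) where
  open Field F using (Carrier; _≈_; _+_; _*_; -_; _-_; 0#; 1#; inv)

  Σl : List Carrier → Carrier
  Σl = foldr _+_ 0#

  Πl : List Carrier → Carrier
  Πl = foldr _*_ 1#

  pow : Carrier → ℕ → Carrier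
  pow x zero    = 1#
  pow x (suc d) = x * pow x d

  -- Polynomials over F are represented by coefficient functions
  -- ℕ → Carrier (m ↦ coefficient of x^m); all polynomials used below have
  -- finite support, and polynomial equality is coefficientwise ≈.

  monomial : ℕ → (ℕ → Carrier)
  monomial n m with n ℕ.≟ m
  ... | yes _ = 1#
  ... | no  _ = 0#

  mulXminus : Carrier → (ℕ → Carrier) → (ℕ → Carrier)
  mulXminus a p zero    = - (a * p zero)
  mulXminus a p (suc m) = p m - a * p (suc m)

  module _ (ψ : ℕ → Carrier) (ψ≉0 : ∀ n → ¬ (ψ n ≈ 0#)) where

    -- n_ψ = ψ_{n-1} / ψ_n   (only used for n ≥ 1)
    nψ : ℕ → Carrier
    nψ n = ψ (n ∸ 1) * inv (ψ n) (ψ≉0 n)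

    -- constant of the (j+1)-th factor of ψ_k(x): the factors are
    -- x, x - 1_ψ, ..., x - (k-1)_ψ
    factorConst : ℕ → Carrier
    factorConst zero    = 0#
    factorConst (suc j) = nψ (suc j)

    fallψ : ℕ → (ℕ → Carrier)
    fallψ zero    = monomial 0
    fallψ (suc k) = mulXminus (factorConst k) (fallψ k)

    IsPsiStirling : (ℕ → ℕ → Carrier) → Set ℓ
    IsPsiStirling S = ∀ n m →
      monomial n m ≈ Σl (map (λ k → S n k * fallψ k m) (range 0 n))

    sumIncreasing : ℕ → ℕ → Carrier
    sumIncreasing n k =
      Σl (map (λ v → Πl (map nψ (toList v)))
              (filter (λ v → linked? _≤?_ (toList v))
                      (allVecs (n ∸ k) (range 1 k))))

    sumCompositions : ℕ → ℕ → Carrier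
    sumCompositions n k =
      Σl (map (λ d → Πl (toList (Vec.zipWith pow
                          (Vec.tabulate (λ i → nψ (suc (toℕ i)))) d)))
              (filter (λ d → Vec.sum d ℕ.≟ (n ∸ k))
                      (allVecs k (range 0 (n ∸ k)))))

module Submission where

-- The ψ-Stirling numbers obey the triangular recurrence
-- S(n+1,k+1) = S(n,k) + (k+1)_ψ S(n,k+1): multiply x^n = Σ S(n,k) ψ_k(x) by x, use
-- x ψ_k = ψ_{k+1} + k_ψ ψ_k, and compare coefficients, which are unique because ψ_k is
-- monic of degree k. The complete homogeneous symmetric polynomial h_m satisfies the same
-- recurrence h_{m+1}(x_1..x_{k+1}) = h_{m+1}(x_1..x_k) + x_{k+1} h_m(x_1..x_{k+1}), hence
-- S(n,k) = h_{n-k}(1_ψ, …, k_ψ). Both sums of the statement expand h_{n-k}: the first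
-- by splitting off the smallest index of a weakly increasing sequence, the second by
-- splitting off the exponent of the first variable.

open import Defs
open import Data.Bool using (Bool; true; false; _∧_)
open import Data.Nat as ℕ using (ℕ; zero; suc; _∸_; _≤_; _<_; z≤n; s≤s; _≤?_; _≟_)
import Data.Nat.Properties as ℕ
open import Data.Product using (_×_; _,_)
open import Data.Sum using (_⊎_; inj₁; inj₂)
open import Data.Fin using (toℕ)
open import Data.List using (List; []; _∷_; _∷ʳ_; _++_; map; filter; concatMap; applyUpTo)
open import Data.List.Properties using (map-∘; map-++; map-upTo; map-applyUpTo; applyUpTo-∷ʳ)
open import Data.List.Relation.Unary.All as All using (All; []; _∷_)
import Data.List.Relation.Unary.All.Properties as All
open import Data.List.Relation.Unary.AllPairs as AllPairs using (AllPairs; _∷_)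
import Data.List.Relation.Unary.AllPairs.Properties as AllPairs
open import Data.List.Relation.Unary.Linked using (linked?)
open import Data.Vec as Vec using (Vec; toList)
open import Function using (_∘_; mk⇔)
open import Relation.Nullary using (¬_; Dec; yes; no; does; _×-dec_)
open import Relation.Nullary.Decidable using (does-⇔)
open import Relation.Nullary.Negation using (contradiction)
open import Relation.Binary.PropositionalEquality as ≡ using (_≡_; _≢_)
import Algebra.Properties.CommutativeSemigroup as CommutativeSemigroupProperties
import Algebra.Properties.Group as GroupProperties
import Relation.Binary.Reasoning.Setoid as SetoidReasoning

toList-tabulate : ∀ {a} {A : Set a} k (f : ℕ → A) →
  toList (Vec.tabulate {n = k} (f ∘ toℕ)) ≡ applyUpTo f k
toList-tabulate zero    f = ≡.refl
toList-tabulate (suc k) f = ≡.cong (f 0 ∷_) (toList-tabulate k (f ∘ suc))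

map-range0 : ∀ {a} {A : Set a} (f : ℕ → A) n → map f (range 0 n) ≡ applyUpTo f (suc n)
map-range0 f n = ≡.trans (≡.sym (map-∘ (applyUpTo (λ i → i) (suc n)))) (map-upTo f (suc n))

range1≡applyUpTo-suc : ∀ k → range 1 k ≡ applyUpTo suc k
range1≡applyUpTo-suc k = map-upTo suc k

does-linked?-0∷ : ∀ xs → does (linked? _≤?_ (0 ∷ xs)) ≡ does (linked? _≤?_ xs)
does-linked?-0∷ []      = ≡.refl
does-linked?-0∷ (_ ∷ _) = ≡.refl

does-+≟ : ∀ j s m → does (j ℕ.+ s ≟ m) ≡ does (j ≤? m) ∧ does (s ≟ m ∸ j)
does-+≟ j s m = does-⇔ (mk⇔ split merge) (j ℕ.+ s ≟ m) ((j ≤? m) ×-dec (s ≟ m ∸ j))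
  where
  split : j ℕ.+ s ≡ m → j ≤ m × s ≡ m ∸ j
  split ≡.refl = ℕ.m≤m+n j s , ≡.sym (ℕ.m+n∸m≡n j s)
  merge : j ≤ m × s ≡ m ∸ j → j ℕ.+ s ≡ m
  merge (j≤m , ≡.refl) = ℕ.m+[n∸m]≡n j≤m

module _ {c ℓ} (F : Field c ℓ) where
  open Field F hiding (zero)
  open SetoidReasoning setoid
  open CommutativeSemigroupProperties +-commutativeSemigroup using (interchange)
  open CommutativeSemigroupProperties *-commutativeSemigroup using (x∙yz≈y∙xz)
  open GroupProperties +-group using () renaming (∙-cancelʳ to +-cancelʳ; ε⁻¹≈ε to -0#≈0#)

  *-≈0ʳ : ∀ x {z} → z ≈ 0# → x * z ≈ 0#
  *-≈0ʳ x z≈0 = trans (*-cong refl z≈0) (zeroʳ x)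

  *-≈0ˡ : ∀ {z} x → z ≈ 0# → z * x ≈ 0#
  *-≈0ˡ x z≈0 = trans (*-cong z≈0 refl) (zeroˡ x)

  x-c*0≈x : ∀ {x c z} → z ≈ 0# → x - c * z ≈ x
  x-c*0≈x {x} {c} {z} z≈0 = begin
    x - c * z   ≈⟨ +-cong refl (-‿cong (*-≈0ʳ c z≈0)) ⟩
    x - 0#      ≈⟨ +-cong refl -0#≈0# ⟩
    x + 0#      ≈⟨ +-identityʳ x ⟩
    x           ∎

  when : Bool → Carrier → Carrier
  when true  z = z
  when false z = 0#

  when-cong : ∀ b {z z′} → z ≈ z′ → when b z ≈ when b z′
  when-cong true  z≈z′ = z≈z′
  when-cong false _    = refl

  when-does-cong : ∀ {p} {P : Set p} (P? : Dec P) {z z′} → (P → z ≈ z′) →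
    when (does P?) z ≈ when (does P?) z′
  when-does-cong (yes p) z≈z′ = z≈z′ p
  when-does-cong (no _)  _    = refl

  when-yes : ∀ {p} {P : Set p} (P? : Dec P) z → P → when (does P?) z ≈ z
  when-yes (yes _) z _ = refl
  when-yes (no ¬p) z p = contradiction p ¬p

  when-no : ∀ {p} {P : Set p} (P? : Dec P) z → ¬ P → when (does P?) z ≈ 0#
  when-no (yes p) z ¬p = contradiction p ¬p
  when-no (no _)  z _  = refl

  when-*ˡ : ∀ b a z → when b (a * z) ≈ a * when b z
  when-*ˡ true  a z = refl
  when-*ˡ false a z = sym (zeroʳ a)

  when-∧-*ˡ : ∀ b b′ a z → when (b ∧ b′) (a * z) ≈ when b (a * when b′ z)
  when-∧-*ˡ true  b′ a z = when-*ˡ b′ a z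
  when-∧-*ˡ false b′ a z = refl

  sumBelow : ℕ → (ℕ → Carrier) → Carrier
  sumBelow zero    f = 0#
  sumBelow (suc n) f = f 0 + sumBelow n (f ∘ suc)

  -- Binds tighter than _+_ and looser than _*_: ∑[ i < n ] a i * b i + c = (∑ a i b i) + c.
  infix 6.5 sumBelow
  syntax sumBelow n (λ i → e) = ∑[ i < n ] e

  ∑-cong : ∀ n {f g : ℕ → Carrier} → (∀ i → f i ≈ g i) → ∑[ i < n ] f i ≈ ∑[ i < n ] g i
  ∑-cong zero    f≈g = refl
  ∑-cong (suc n) f≈g = +-cong (f≈g 0) (∑-cong n (f≈g ∘ suc))

  ∑-zero : ∀ n {f : ℕ → Carrier} → (∀ i → i < n → f i ≈ 0#) → ∑[ i < n ] f i ≈ 0#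
  ∑-zero zero        f≈0 = refl
  ∑-zero (suc n) {f} f≈0 = begin
    f 0 + ∑[ i < n ] f (suc i)
      ≈⟨ +-cong (f≈0 0 (s≤s z≤n)) (∑-zero n (λ i i<n → f≈0 (suc i) (s≤s i<n))) ⟩
    0# + 0#                    ≈⟨ +-identityˡ 0# ⟩
    0#                         ∎

  ∑-+ : ∀ n (f g : ℕ → Carrier) → ∑[ i < n ] (f i + g i) ≈ ∑[ i < n ] f i + ∑[ i < n ] g i
  ∑-+ zero    f g = sym (+-identityˡ 0#)
  ∑-+ (suc n) f g =
    trans (+-cong refl (∑-+ n (f ∘ suc) (g ∘ suc))) (interchange (f 0) (g 0) _ _)

  ∑-*ˡ : ∀ n a (f : ℕ → Carrier) → ∑[ i < n ] (a * f i) ≈ a * (∑[ i < n ] f i)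
  ∑-*ˡ zero    a f = sym (zeroʳ a)
  ∑-*ˡ (suc n) a f = trans (+-cong refl (∑-*ˡ n a (f ∘ suc))) (sym (distribˡ a _ _))

  ∑-last : ∀ n (f : ℕ → Carrier) → ∑[ i < suc n ] f i ≈ ∑[ i < n ] f i + f n
  ∑-last zero    f = +-comm (f 0) 0#
  ∑-last (suc n) f = trans (+-cong refl (∑-last n (f ∘ suc))) (sym (+-assoc _ _ _))

  ∑-shift : ∀ n (f : ℕ → Carrier) → f 0 ≈ 0# → f n ≈ 0# →
    ∑[ i < n ] f i ≈ ∑[ i < n ] f (suc i)
  ∑-shift zero    f _    _    = refl
  ∑-shift (suc n) f f0≈0 fn≈0 = begin
    f 0 + ∑[ i < n ] f (suc i)       ≈⟨ +-cong f0≈0 refl ⟩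
    0# + ∑[ i < n ] f (suc i)        ≈⟨ +-comm 0# _ ⟩
    ∑[ i < n ] f (suc i) + 0#        ≈⟨ +-cong refl (sym fn≈0) ⟩
    ∑[ i < n ] f (suc i) + f (suc n) ≈⟨ ∑-last n (f ∘ suc) ⟨
    ∑[ i < suc n ] f (suc i)         ∎

  Σl-applyUpTo : ∀ n (f : ℕ → Carrier) → Σl F (applyUpTo f n) ≡ ∑[ i < n ] f i
  Σl-applyUpTo zero    f = ≡.refl
  Σl-applyUpTo (suc n) f = ≡.cong (f 0 +_) (Σl-applyUpTo n (f ∘ suc))

  Σl-range0 : ∀ n (f : ℕ → Carrier) → Σl F (map f (range 0 n)) ≡ ∑[ i < suc n ] f i
  Σl-range0 n f = ≡.trans (≡.cong (Σl F) (map-range0 f n)) (Σl-applyUpTo (suc n) f)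

  module _ {a} {A : Set a} where

    Σl-cong : ∀ xs {f g : A → Carrier} → (∀ x → f x ≈ g x) → Σl F (map f xs) ≈ Σl F (map g xs)
    Σl-cong []       f≈g = refl
    Σl-cong (x ∷ xs) f≈g = +-cong (f≈g x) (Σl-cong xs f≈g)

    Σl-cong-All : ∀ {p} {P : A → Set p} {xs} {f g : A → Carrier} →
      All P xs → (∀ {x} → P x → f x ≈ g x) → Σl F (map f xs) ≈ Σl F (map g xs)
    Σl-cong-All []         f≈g = refl
    Σl-cong-All (px ∷ pxs) f≈g = +-cong (f≈g px) (Σl-cong-All pxs f≈g)

    Σl-++ : ∀ xs ys → Σl F (xs ++ ys) ≈ Σl F xs + Σl F ys
    Σl-++ []       ys = sym (+-identityˡ _)
    Σl-++ (x ∷ xs) ys = trans (+-cong refl (Σl-++ xs ys)) (sym (+-assoc _ _ _))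

    Σl-*ˡ : ∀ a (f : A → Carrier) xs → Σl F (map (λ x → a * f x) xs) ≈ a * Σl F (map f xs)
    Σl-*ˡ a f []       = sym (zeroʳ a)
    Σl-*ˡ a f (x ∷ xs) = trans (+-cong refl (Σl-*ˡ a f xs)) (sym (distribˡ a _ _))

    Σl-when : ∀ b (f : A → Carrier) xs → Σl F (map (λ x → when b (f x)) xs) ≈ when b (Σl F (map f xs))
    Σl-when true  f xs       = refl
    Σl-when false f []       = refl
    Σl-when false f (x ∷ xs) = trans (+-identityˡ _) (Σl-when false f xs)

    Σl-when-*ˡ : ∀ b a (f : A → Carrier) xs →
      Σl F (map (λ x → when b (a * f x)) xs) ≈ when b (a * Σl F (map f xs))
    Σl-when-*ˡ b a f xs = trans (Σl-when b (λ x → a * f x) xs) (when-cong b (Σl-*ˡ a f xs))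

    Σl-filter : ∀ {p} {P : A → Set p} (P? : ∀ x → Dec (P x)) (f : A → Carrier) xs →
      Σl F (map f (filter P? xs)) ≈ Σl F (map (λ x → when (does (P? x)) (f x)) xs)
    Σl-filter P? f [] = refl
    Σl-filter P? f (x ∷ xs) with does (P? x)
    ... | true  = +-cong refl (Σl-filter P? f xs)
    ... | false = trans (Σl-filter P? f xs) (sym (+-identityˡ _))

    Σl-concatMap : ∀ {b} {B : Set b} (f : B → Carrier) (g : A → List B) xs →
      Σl F (map f (concatMap g xs)) ≈ Σl F (map (λ x → Σl F (map f (g x))) xs)
    Σl-concatMap f g []       = refl
    Σl-concatMap f g (x ∷ xs) = begin
      Σl F (map f (g x ++ concatMap g xs))               ≡⟨ ≡.cong (Σl F) (map-++ f (g x) _) ⟩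
      Σl F (map f (g x) ++ map f (concatMap g xs))       ≈⟨ Σl-++ (map f (g x)) _ ⟩
      Σl F (map f (g x)) + Σl F (map f (concatMap g xs)) ≈⟨ +-cong refl (Σl-concatMap f g xs) ⟩
      Σl F (map f (g x)) + Σl F (map (λ y → Σl F (map f (g y))) xs) ∎

    Σl-allVecs-suc : ∀ k L (f : Vec A (suc k) → Carrier) →
      Σl F (map f (allVecs (suc k) L))
        ≈ Σl F (map (λ x → Σl F (map (f ∘ (x Vec.∷_)) (allVecs k L))) L)
    Σl-allVecs-suc k L f = trans (Σl-concatMap f (λ x → map (x Vec.∷_) (allVecs k L)) L)
      (Σl-cong L (λ x → reflexive (≡.cong (Σl F) (≡.sym (map-∘ (allVecs k L))))))

  completeHomogeneous : ℕ → List Carrier → Carrier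
  completeHomogeneous zero    vs       = 1#
  completeHomogeneous (suc m) []       = 0#
  completeHomogeneous (suc m) (v ∷ vs) =
    v * completeHomogeneous m (v ∷ vs) + completeHomogeneous (suc m) vs

  private
    h : ℕ → List Carrier → Carrier
    h = completeHomogeneous

  h-∷ʳ : ∀ vs m w → h (suc m) (vs ∷ʳ w) ≈ h (suc m) vs + w * h m (vs ∷ʳ w)
  h-∷ʳ []       m       w = +-comm _ 0#
  h-∷ʳ (v ∷ vs) zero    w = begin
    v * 1# + h 1 (vs ∷ʳ w)          ≈⟨ +-cong refl (h-∷ʳ vs zero w) ⟩
    v * 1# + (h 1 vs + w * 1#)      ≈⟨ +-assoc _ _ _ ⟨
    (v * 1# + h 1 vs) + w * 1#      ∎
  h-∷ʳ (v ∷ vs) (suc m) w = begin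
    v * h (suc m) (v ∷ vs ∷ʳ w) + h (2 ℕ.+ m) (vs ∷ʳ w)
      ≈⟨ +-cong (*-cong refl (h-∷ʳ (v ∷ vs) m w)) (h-∷ʳ vs (suc m) w) ⟩
    v * (p + w * q) + (r + w * t)       ≈⟨ +-cong (trans (distribˡ v p _) (+-cong refl (x∙yz≈y∙xz v w q))) refl ⟩
    (v * p + w * (v * q)) + (r + w * t) ≈⟨ interchange _ _ _ _ ⟩
    (v * p + r) + (w * (v * q) + w * t) ≈⟨ +-cong refl (distribˡ w _ _) ⟨
    (v * p + r) + w * (v * q + t)       ∎
    where
    p q r t : Carrier
    p = h (suc m) (v ∷ vs)
    q = h m (v ∷ vs ∷ʳ w)
    r = h (2 ℕ.+ m) vs
    t = h (suc m) (vs ∷ʳ w)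

  h-∷-powers : ∀ v vs m B → m ≤ B →
    h m (v ∷ vs) ≈ ∑[ j < suc B ] when (does (j ≤? m)) (pow F v j * h (m ∸ j) vs)
  h-∷-powers v vs zero B _ = sym (begin
    1# * 1# + ∑[ j < B ] 0# ≈⟨ +-cong (*-identityˡ 1#) (∑-zero B (λ _ _ → refl)) ⟩
    1# + 0#                 ≈⟨ +-identityʳ 1# ⟩
    1#                      ∎)
  h-∷-powers v vs (suc m) (suc B) (s≤s m≤B) = sym (begin
    1# * h (suc m) vs + ∑[ j < suc B ] when (does (suc j ≤? suc m)) ((v * pow F v j) * h (m ∸ j) vs)
      ≈⟨ +-cong (*-identityˡ _) (∑-cong (suc B) pull-v) ⟩
    h (suc m) vs + ∑[ j < suc B ] (v * when (does (j ≤? m)) (pow F v j * h (m ∸ j) vs))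
      ≈⟨ +-cong refl (∑-*ˡ (suc B) v (λ j → when (does (j ≤? m)) (pow F v j * h (m ∸ j) vs))) ⟩
    h (suc m) vs + v * (∑[ j < suc B ] when (does (j ≤? m)) (pow F v j * h (m ∸ j) vs))
      ≈⟨ +-cong refl (*-cong refl (h-∷-powers v vs m B m≤B)) ⟨
    h (suc m) vs + v * h m (v ∷ vs)
      ≈⟨ +-comm _ _ ⟩
    v * h m (v ∷ vs) + h (suc m) vs ∎)
    where
    pull-v : ∀ j → when (does (suc j ≤? suc m)) ((v * pow F v j) * h (m ∸ j) vs)
                   ≈ v * when (does (j ≤? m)) (pow F v j * h (m ∸ j) vs)
    pull-v j rewrite does-⇔ (mk⇔ ℕ.s≤s⁻¹ s≤s) (suc j ≤? suc m) (j ≤? m) =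
      trans (when-cong (does (j ≤? m)) (*-assoc _ _ _)) (when-*ˡ (does (j ≤? m)) v _)

  monomialWeight : ∀ {k} → Vec Carrier k → Vec ℕ k → Carrier
  monomialWeight w d = Πl F (toList (Vec.zipWith (pow F) w d))

  Σl-compositions : ∀ k (w : Vec Carrier k) m B → m ≤ B →
    Σl F (map (λ d → when (does (Vec.sum d ≟ m)) (monomialWeight w d)) (allVecs k (range 0 B)))
      ≈ h m (toList w)
  Σl-compositions zero    Vec.[]      zero    B _   = +-identityʳ 1#
  Σl-compositions zero    Vec.[]      (suc m) B _   = +-identityʳ 0#
  Σl-compositions (suc k) (v Vec.∷ w) m       B m≤B = begin
    Σl F (map G (allVecs (suc k) (range 0 B)))
      ≈⟨ Σl-allVecs-suc k (range 0 B) G ⟩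
    Σl F (map (λ j → Σl F (map (G ∘ (j Vec.∷_)) V)) (range 0 B))
      ≈⟨ Σl-cong (range 0 B) first-exponent ⟩
    Σl F (map first-term (range 0 B))
      ≡⟨ Σl-range0 B first-term ⟩
    ∑[ j < suc B ] first-term j
      ≈⟨ h-∷-powers v (toList w) m B m≤B ⟨
    h m (v ∷ toList w) ∎
    where
    V : List (Vec ℕ k)
    V = allVecs k (range 0 B)
    rest : ℕ → Vec ℕ k → Carrier
    rest m′ d = when (does (Vec.sum d ≟ m′)) (monomialWeight w d)
    G : Vec ℕ (suc k) → Carrier
    G d = when (does (Vec.sum d ≟ m)) (monomialWeight (v Vec.∷ w) d)
    first-term : ℕ → Carrier
    first-term j = when (does (j ≤? m)) (pow F v j * h (m ∸ j) (toList w))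
    split-guard : ∀ j d → G (j Vec.∷ d) ≈ when (does (j ≤? m)) (pow F v j * rest (m ∸ j) d)
    split-guard j d rewrite does-+≟ j (Vec.sum d) m =
      when-∧-*ˡ (does (j ≤? m)) (does (Vec.sum d ≟ m ∸ j)) (pow F v j) (monomialWeight w d)
    first-exponent : ∀ j → Σl F (map (G ∘ (j Vec.∷_)) V) ≈ first-term j
    first-exponent j = begin
      Σl F (map (G ∘ (j Vec.∷_)) V)
        ≈⟨ Σl-cong V (split-guard j) ⟩
      Σl F (map (λ d → when (does (j ≤? m)) (pow F v j * rest (m ∸ j) d)) V)
        ≈⟨ Σl-when-*ˡ (does (j ≤? m)) (pow F v j) (rest (m ∸ j)) V ⟩
      when (does (j ≤? m)) (pow F v j * Σl F (map (rest (m ∸ j)) V))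
        ≈⟨ when-cong (does (j ≤? m))
             (*-cong refl (Σl-compositions k w (m ∸ j) B (ℕ.≤-trans (ℕ.m∸n≤m m j) m≤B))) ⟩
      first-term j ∎

  module _ (f : ℕ → Carrier) where

    private
      weight : ∀ {k} → Vec ℕ k → Carrier
      weight v = Πl F (map f (toList v))

      increasingWeight : ∀ {k} → ℕ → Vec ℕ k → Carrier
      increasingWeight lo v = when (does (linked? _≤?_ (lo ∷ toList v))) (weight v)

    increasingSumFrom : List ℕ → ℕ → ℕ → Carrier
    increasingSumFrom L m lo = Σl F (map (increasingWeight lo) (allVecs m L))

    private
      I : List ℕ → ℕ → ℕ → Carrier
      I = increasingSumFrom

    private
      startingWith : List ℕ → ℕ → ℕ → ℕ → Carrier
      startingWith L m lo y = when (does (lo ≤? y)) (f y * I L m y)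

    increasingSumFrom-suc : ∀ L m lo → I L (suc m) lo ≈ Σl F (map (startingWith L m lo) L)
    increasingSumFrom-suc L m lo =
      trans (Σl-allVecs-suc m L (increasingWeight lo)) (Σl-cong L first-entry)
      where
      first-entry : ∀ y →
        Σl F (map (increasingWeight lo ∘ (y Vec.∷_)) (allVecs m L)) ≈ startingWith L m lo y
      first-entry y =
        trans (Σl-cong (allVecs m L) (λ v → when-∧-*ˡ (does (lo ≤? y)) _ (f y) (weight v)))
              (Σl-when-*ˡ (does (lo ≤? y)) (f y) (increasingWeight y) (allVecs m L))

    increasingSumFrom-drop : ∀ x L m lo → x < lo → I (x ∷ L) m lo ≈ I L m lo
    increasingSumFrom-drop x L zero    lo x<lo = refl
    increasingSumFrom-drop x L (suc m) lo x<lo = begin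
      I (x ∷ L) (suc m) lo
        ≈⟨ increasingSumFrom-suc (x ∷ L) m lo ⟩
      startingWith (x ∷ L) m lo x + Σl F (map (startingWith (x ∷ L) m lo) L)
        ≈⟨ +-cong (when-no (lo ≤? x) _ (ℕ.<⇒≱ x<lo)) (Σl-cong L drop-below) ⟩
      0# + Σl F (map (startingWith L m lo) L)
        ≈⟨ +-identityˡ _ ⟩
      Σl F (map (startingWith L m lo) L)
        ≈⟨ increasingSumFrom-suc L m lo ⟨
      I L (suc m) lo ∎
      where
      drop-below : ∀ y → startingWith (x ∷ L) m lo y ≈ startingWith L m lo y
      drop-below y = when-does-cong (lo ≤? y)
        (λ lo≤y → *-cong refl (increasingSumFrom-drop x L m y (ℕ.<-≤-trans x<lo lo≤y)))

    increasingSumFrom-sorted : ∀ m L lo → AllPairs _<_ L → All (lo ≤_) L → I L m lo ≈ h m (map f L)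
    increasingSumFrom-sorted zero    L       lo _          _             = +-identityʳ 1#
    increasingSumFrom-sorted (suc m) []      lo _          _             = refl
    increasingSumFrom-sorted (suc m) (x ∷ L) lo (x<L ∷ L<) (lo≤x ∷ lo≤L) = begin
      I (x ∷ L) (suc m) lo
        ≈⟨ increasingSumFrom-suc (x ∷ L) m lo ⟩
      startingWith (x ∷ L) m lo x + Σl F (map (startingWith (x ∷ L) m lo) L)
        ≈⟨ +-cong (when-yes (lo ≤? x) _ lo≤x) (Σl-cong-All (All.zip (lo≤L , x<L)) drop-x) ⟩
      f x * I (x ∷ L) m x + Σl F (map (startingWith L m x) L)
        ≈⟨ +-cong (*-cong refl (increasingSumFrom-sorted m (x ∷ L) x (x<L ∷ L<) (ℕ.≤-refl ∷ x≤L)))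
                  (sym (increasingSumFrom-suc L m x)) ⟩
      f x * h m (map f (x ∷ L)) + I L (suc m) x
        ≈⟨ +-cong refl (increasingSumFrom-sorted (suc m) L x L< x≤L) ⟩
      f x * h m (map f (x ∷ L)) + h (suc m) (map f L) ∎
      where
      x≤L : All (x ≤_) L
      x≤L = All.map ℕ.<⇒≤ x<L
      drop-x : ∀ {y} → lo ≤ y × x < y → startingWith (x ∷ L) m lo y ≈ startingWith L m x y
      drop-x {y} (lo≤y , x<y) = begin
        when (does (lo ≤? y)) (f y * I (x ∷ L) m y) ≈⟨ when-yes (lo ≤? y) _ lo≤y ⟩
        f y * I (x ∷ L) m y                         ≈⟨ *-cong refl (increasingSumFrom-drop x L m y x<y) ⟩
        f y * I L m y                               ≈⟨ when-yes (x ≤? y) _ (ℕ.<⇒≤ x<y) ⟨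
        when (does (x ≤? y)) (f y * I L m y)        ∎

  monomial-diag : ∀ n → monomial F n n ≈ 1#
  monomial-diag n with n ≟ n
  ... | yes _   = refl
  ... | no  n≢n = contradiction ≡.refl n≢n

  monomial-off : ∀ n m → n ≢ m → monomial F n m ≈ 0#
  monomial-off n m n≢m with n ≟ m
  ... | yes n≡m = contradiction n≡m n≢m
  ... | no  _   = refl

  monomial-suc : ∀ n m → monomial F (suc n) (suc m) ≈ monomial F n m
  monomial-suc n m = by-cases (n ≟ m)
    where
    by-cases : Dec (n ≡ m) → monomial F (suc n) (suc m) ≈ monomial F n m
    by-cases (yes ≡.refl) = trans (monomial-diag (suc n)) (sym (monomial-diag n))
    by-cases (no n≢m)     =
      trans (monomial-off (suc n) (suc m) (n≢m ∘ ℕ.suc-injective)) (sym (monomial-off n m n≢m))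

  module _ (ψ : ℕ → Carrier) (ψ≉0 : ∀ n → ¬ (ψ n ≈ 0#)) where

    private
      fall : ℕ → ℕ → Carrier
      fall = fallψ F ψ ψ≉0
      a ν : ℕ → Carrier
      a = factorConst F ψ ψ≉0
      ν = nψ F ψ ψ≉0

    fall-above : ∀ k m → k < m → fall k m ≈ 0#
    fall-above zero    m       k<m       = monomial-off 0 m (ℕ.<⇒≢ k<m)
    fall-above (suc k) (suc m) (s≤s k<m) =
      trans (x-c*0≈x (fall-above k (suc m) (ℕ.m<n⇒m<1+n k<m))) (fall-above k m k<m)

    fall-diag : ∀ k → fall k k ≈ 1#
    fall-diag zero    = monomial-diag 0
    fall-diag (suc k) = trans (x-c*0≈x (fall-above k (suc k) (ℕ.n<1+n k))) (fall-diag k)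

    fall-at-0 : ∀ k → fall (suc k) 0 ≈ 0#
    fall-at-0 k = trans (-‿cong (a*fall≈0 k)) -0#≈0#
      where
      a*fall≈0 : ∀ k → a k * fall k 0 ≈ 0#
      a*fall≈0 zero    = zeroˡ _
      a*fall≈0 (suc k) = *-≈0ʳ (a (suc k)) (fall-at-0 k)

    -- x ψ_k(x) = ψ_{k+1}(x) + a_k ψ_k(x), at the coefficient of x^(m+1).
    fall-step : ∀ k m → fall k m ≈ fall (suc k) (suc m) + a k * fall k (suc m)
    fall-step k m = sym (begin
      (fall k m - a k * fall k (suc m)) + a k * fall k (suc m)     ≈⟨ +-assoc _ _ _ ⟩
      fall k m + (- (a k * fall k (suc m)) + a k * fall k (suc m)) ≈⟨ +-cong refl (-‿inverseˡ _) ⟩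
      fall k m + 0#                                                ≈⟨ +-identityʳ _ ⟩
      fall k m                                                     ∎)

    -- S(n+1, 0) = 0 since a₀ = 0, i.e. x is the first factor of every ψ_{k+1}(x).
    stirling : ℕ → ℕ → Carrier
    stirling zero    zero    = 1#
    stirling zero    (suc k) = 0#
    stirling (suc n) zero    = 0#
    stirling (suc n) (suc k) = stirling n k + ν (suc k) * stirling n (suc k)

    stirling-above : ∀ n k → n < k → stirling n k ≈ 0#
    stirling-above zero    (suc k) _         = refl
    stirling-above (suc n) (suc k) (s≤s n<k) = begin
      stirling n k + ν (suc k) * stirling n (suc k)
        ≈⟨ +-cong (stirling-above n k n<k)
                  (*-≈0ʳ (ν (suc k)) (stirling-above n (suc k) (ℕ.m<n⇒m<1+n n<k))) ⟩
      0# + 0# ≈⟨ +-identityˡ 0# ⟩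
      0#      ∎

    monomial≈∑stirling : ∀ n m → monomial F n m ≈ ∑[ k < suc n ] stirling n k * fall k m
    monomial≈∑stirling zero    m       = sym (trans (+-identityʳ _) (*-identityˡ _))
    monomial≈∑stirling (suc n) zero    = sym (begin
      0# * fall 0 0 + ∑[ k < suc n ] stirling (suc n) (suc k) * fall (suc k) 0
        ≈⟨ +-cong (zeroˡ _) (∑-zero (suc n) (λ k _ → *-≈0ʳ (stirling (suc n) (suc k)) (fall-at-0 k))) ⟩
      0# + 0#              ≈⟨ +-identityˡ 0# ⟩
      0#                   ≈⟨ monomial-off (suc n) 0 (λ ()) ⟨
      monomial F (suc n) 0 ∎)
    monomial≈∑stirling (suc n) (suc m) = begin
      monomial F (suc n) (suc m)                    ≈⟨ monomial-suc n m ⟩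
      monomial F n m                                ≈⟨ monomial≈∑stirling n m ⟩
      ∑[ k < suc n ] stirling n k * fall k m        ≈⟨ ∑-cong (suc n) split ⟩
      ∑[ k < suc n ] (A k + B k)                    ≈⟨ ∑-+ (suc n) A B ⟩
      ∑[ k < suc n ] A k + ∑[ k < suc n ] B k       ≈⟨ +-cong refl (∑-shift (suc n) B (zeroˡ _) B-top) ⟩
      ∑[ k < suc n ] A k + ∑[ k < suc n ] B (suc k) ≈⟨ ∑-+ (suc n) A (B ∘ suc) ⟨
      ∑[ k < suc n ] (A k + B (suc k))              ≈⟨ ∑-cong (suc n) recurrence ⟨
      ∑[ k < suc n ] stirling (suc n) (suc k) * fall (suc k) (suc m)
        ≈⟨ trans (+-cong (zeroˡ _) refl) (+-identityˡ _) ⟨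
      ∑[ k < suc (suc n) ] stirling (suc n) k * fall k (suc m) ∎
      where
      A B : ℕ → Carrier
      A k = stirling n k * fall (suc k) (suc m)
      B k = a k * (stirling n k * fall k (suc m))
      split : ∀ k → stirling n k * fall k m ≈ A k + B k
      split k = trans (*-cong refl (fall-step k m)) (trans (distribˡ _ _ _) (+-cong refl (x∙yz≈y∙xz _ _ _)))
      B-top : B (suc n) ≈ 0#
      B-top = *-≈0ʳ (a (suc n)) (*-≈0ˡ (fall (suc n) (suc m)) (stirling-above n (suc n) (ℕ.n<1+n n)))
      recurrence : ∀ k → stirling (suc n) (suc k) * fall (suc k) (suc m) ≈ A k + B (suc k)
      recurrence k = trans (distribʳ _ _ _) (+-cong refl (*-assoc _ _ _))

    ∑-fall-top : ∀ N (c : ℕ → Carrier) → ∑[ k < suc N ] c k * fall k N ≈ c N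
    ∑-fall-top N c = begin
      ∑[ k < suc N ] c k * fall k N             ≈⟨ ∑-last N (λ k → c k * fall k N) ⟩
      ∑[ k < N ] c k * fall k N + c N * fall N N
        ≈⟨ +-cong (∑-zero N (λ k k<N → *-≈0ʳ (c k) (fall-above k N k<N)))
                  (*-cong refl (fall-diag N)) ⟩
      0# + c N * 1#                             ≈⟨ +-identityˡ _ ⟩
      c N * 1#                                  ≈⟨ *-identityʳ _ ⟩
      c N                                       ∎

    fall-coefficients-unique : ∀ N (c d : ℕ → Carrier) →
      (∀ m → ∑[ k < N ] c k * fall k m ≈ ∑[ k < N ] d k * fall k m) → ∀ k → k < N → c k ≈ d k
    fall-coefficients-unique (suc N) c d same k k<1+N = by-cases (ℕ.m<1+n⇒m<n∨m≡n k<1+N)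
      where
      top-equal : c N ≈ d N
      top-equal = trans (sym (∑-fall-top N c)) (trans (same N) (∑-fall-top N d))
      lower-same : ∀ m → ∑[ k < N ] c k * fall k m ≈ ∑[ k < N ] d k * fall k m
      lower-same m = +-cancelʳ (c N * fall N m) _ _ (begin
        ∑[ k < N ] c k * fall k m + c N * fall N m ≈⟨ ∑-last N (λ k → c k * fall k m) ⟨
        ∑[ k < suc N ] c k * fall k m              ≈⟨ same m ⟩
        ∑[ k < suc N ] d k * fall k m              ≈⟨ ∑-last N (λ k → d k * fall k m) ⟩
        ∑[ k < N ] d k * fall k m + d N * fall N m ≈⟨ +-cong refl (*-cong top-equal refl) ⟨
        ∑[ k < N ] d k * fall k m + c N * fall N m ∎)
      by-cases : k < N ⊎ k ≡ N → c k ≈ d k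
      by-cases (inj₁ k<N)    = fall-coefficients-unique N c d lower-same k k<N
      by-cases (inj₂ ≡.refl) = top-equal

    IsPsiStirling⇒≈stirling : ∀ S → IsPsiStirling F ψ ψ≉0 S → ∀ n k → k ≤ n → S n k ≈ stirling n k
    IsPsiStirling⇒≈stirling S isS n k k≤n =
      fall-coefficients-unique (suc n) (S n) (stirling n) same k (s≤s k≤n)
      where
      same : ∀ m → ∑[ k < suc n ] S n k * fall k m ≈ ∑[ k < suc n ] stirling n k * fall k m
      same m = trans (sym (≡.subst (monomial F n m ≈_) (Σl-range0 n (λ k → S n k * fall k m)) (isS n m)))
                     (monomial≈∑stirling n m)

    weights : ℕ → List Carrier
    weights k = applyUpTo (ν ∘ suc) k

    h-weights-suc : ∀ m k →
      h (suc m) (weights (suc k)) ≈ h (suc m) (weights k) + ν (suc k) * h m (weights (suc k))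
    h-weights-suc m k = ≡.subst (λ ws → h (suc m) ws ≈ h (suc m) (weights k) + ν (suc k) * h m ws)
                                (applyUpTo-∷ʳ (ν ∘ suc) k) (h-∷ʳ (weights k) m (ν (suc k)))

    stirling-+ : ∀ m k → stirling (m ℕ.+ k) k ≈ h m (weights k)
    stirling-+ zero    zero    = refl
    stirling-+ zero    (suc k) = begin
      stirling k k + ν (suc k) * stirling k (suc k)
        ≈⟨ +-cong (stirling-+ zero k) (*-≈0ʳ (ν (suc k)) (stirling-above k (suc k) (ℕ.n<1+n k))) ⟩
      1# + 0# ≈⟨ +-identityʳ 1# ⟩
      1#      ∎
    stirling-+ (suc m) zero    = refl
    stirling-+ (suc m) (suc k) = begin
      stirling (m ℕ.+ suc k) k + ν (suc k) * stirling (m ℕ.+ suc k) (suc k)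
        ≈⟨ +-cong (≡.subst (λ i → stirling i k ≈ h (suc m) (weights k)) (≡.sym (ℕ.+-suc m k))
                           (stirling-+ (suc m) k))
                  (*-cong refl (stirling-+ m (suc k))) ⟩
      h (suc m) (weights k) + ν (suc k) * h m (weights (suc k))
        ≈⟨ h-weights-suc m k ⟨
      h (suc m) (weights (suc k)) ∎

    stirling≈h : ∀ {n k} → k ≤ n → stirling n k ≈ h (n ∸ k) (weights k)
    stirling≈h {n} {k} k≤n =
      ≡.subst (λ i → stirling i k ≈ h (n ∸ k) (weights k)) (ℕ.m∸n+n≡m k≤n) (stirling-+ (n ∸ k) k)

    sumIncreasing≈h : ∀ n k → sumIncreasing F ψ ψ≉0 n k ≈ h (n ∸ k) (weights k)
    sumIncreasing≈h n k = begin
      sumIncreasing F ψ ψ≉0 n k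
        ≈⟨ Σl-filter (linked? _≤?_ ∘ toList) Πν V ⟩
      Σl F (map (λ v → when (does (linked? _≤?_ (toList v))) (Πν v)) V)
        ≈⟨ Σl-cong V (λ v → reflexive (≡.cong (λ b → when b (Πν v))
                                                 (≡.sym (does-linked?-0∷ (toList v))))) ⟩
      increasingSumFrom ν (range 1 k) (n ∸ k) 0
        ≡⟨ ≡.cong (λ L → increasingSumFrom ν L (n ∸ k) 0) (range1≡applyUpTo-suc k) ⟩
      increasingSumFrom ν (applyUpTo suc k) (n ∸ k) 0
        ≈⟨ increasingSumFrom-sorted ν (n ∸ k) (applyUpTo suc k) 0
             (AllPairs.applyUpTo⁺₁ suc k (λ i<j _ → s≤s i<j))
             (All.applyUpTo⁺₂ suc k (λ _ → z≤n)) ⟩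
      h (n ∸ k) (map ν (applyUpTo suc k))
        ≡⟨ ≡.cong (h (n ∸ k)) (map-applyUpTo suc ν k) ⟩
      h (n ∸ k) (weights k) ∎
      where
      V : List (Vec ℕ (n ∸ k))
      V = allVecs (n ∸ k) (range 1 k)
      Πν : Vec ℕ (n ∸ k) → Carrier
      Πν v = Πl F (map ν (toList v))

    sumCompositions≈h : ∀ n k → sumCompositions F ψ ψ≉0 n k ≈ h (n ∸ k) (weights k)
    sumCompositions≈h n k = begin
      sumCompositions F ψ ψ≉0 n k
        ≈⟨ Σl-filter (λ d → Vec.sum d ≟ n ∸ k) (monomialWeight w) D ⟩
      Σl F (map (λ d → when (does (Vec.sum d ≟ n ∸ k)) (monomialWeight w d)) D)
        ≈⟨ Σl-compositions k w (n ∸ k) (n ∸ k) ℕ.≤-refl ⟩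
      h (n ∸ k) (toList w)
        ≡⟨ ≡.cong (h (n ∸ k)) (toList-tabulate k (ν ∘ suc)) ⟩
      h (n ∸ k) (weights k) ∎
      where
      w : Vec Carrier k
      w = Vec.tabulate (ν ∘ suc ∘ toℕ)
      D : List (Vec ℕ k)
      D = allVecs k (range 0 (n ∸ k))

mainTheorem3 : ∀ {c ℓ} (F : Field c ℓ) → let open Field F in
    (ψ : ℕ → Carrier) (ψ≉0 : ∀ n → ¬ (ψ n ≈ 0#)) →
    (S : ℕ → ℕ → Carrier) → IsPsiStirling F ψ ψ≉0 S →
    ∀ n k → k ≤ n →
      (S n k ≈ sumIncreasing F ψ ψ≉0 n k)
      × (sumIncreasing F ψ ψ≉0 n k ≈ sumCompositions F ψ ψ≉0 n k)
mainTheorem3 F ψ ψ≉0 S isS n k k≤n =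
  trans (IsPsiStirling⇒≈stirling F ψ ψ≉0 S isS n k k≤n)
        (trans (stirling≈h F ψ ψ≉0 k≤n) (sym (sumIncreasing≈h F ψ ψ≉0 n k))) ,
  trans (sumIncreasing≈h F ψ ψ≉0 n k) (sym (sumCompositions≈h F ψ ψ≉0 n k))
  where open Field F using (trans; sym)
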